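{- Let $k\ge1$ and let $\mathcal F$ be a computable Boolean algebra freely generated by a computable sequence $(p_n)_{n\in\omega}$ (with a fixed effective encoding by natural numbers). For any $\Sigma^0_k$ preorder $\preceq$ on $\omega$ there is a $\Sigma^0_k$ ideal $\mathcal I$ of $\mathcal F$ such that for all $n,m\in\omega$: $n\preceq m \iff p_n-p_m\in\mathcal I$.
   Context: In a Boolean algebra, $a-b$ denotes $a\wedge b'$ where $'$ is complementation. An ideal of $\mathcal F$ is $\Sigma^0_k$ if the set of codes of its elements is $\Sigma^0_k$. -}

module Defs where

open import Level using (0ℓ; Lift)
open import Data.Nat using (ℕ; zero; suc)
open import Data.Fin using (Fin)
open import Data.Vec using (Vec; []; _∷_; lookup)
open import Data.Product using (Σ; ∃; _×_; _,_)
open import Function.Bundles using (_⇔_)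
open import Relation.Binary.PropositionalEquality using (_≡_)
open import Relation.Binary.Structures using (IsPreorder)
open import Algebra.Lattice.Structures using (IsBooleanAlgebra)
open import Algebra.Lattice.Bundles using (BooleanAlgebra)

data PR : ℕ → Set where
  zer  : ∀ {n} → PR n
  succ : PR 1
  proj : ∀ {n} → Fin n → PR n
  comp : ∀ {m n} → PR m → Vec (PR n) m → PR n
  prec : ∀ {n} → PR n → PR (suc (suc n)) → PR (suc n)

mutual
  ⟦_⟧ : ∀ {n} → PR n → Vec ℕ n → ℕ
  ⟦ zer ⟧ v = 0
  ⟦ succ ⟧ (x ∷ []) = suc x
  ⟦ proj i ⟧ v = lookup v i
  ⟦ comp f gs ⟧ v = ⟦ f ⟧ (⟦ gs ⟧* v)
  ⟦ prec f g ⟧ (zero ∷ v) = ⟦ f ⟧ v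
  ⟦ prec f g ⟧ (suc x ∷ v) = ⟦ g ⟧ (⟦ prec f g ⟧ (x ∷ v) ∷ x ∷ v)

  ⟦_⟧* : ∀ {m n} → Vec (PR n) m → Vec ℕ n → Vec ℕ m
  ⟦ [] ⟧* v = []
  ⟦ g ∷ gs ⟧* v = ⟦ g ⟧ v ∷ ⟦ gs ⟧* v

mutual
  IsΣ : ℕ → ∀ {m} → (Vec ℕ m → Set) → Set₁
  IsΣ zero    {m} P = Lift _ (Σ (PR m) λ f → ∀ v → P v ⇔ (⟦ f ⟧ v ≡ 0))
  IsΣ (suc k) {m} P = Σ (Vec ℕ (suc m) → Set) λ Q →
                        IsΠ k Q × (∀ v → P v ⇔ ∃ λ x → Q (x ∷ v))

  IsΠ : ℕ → ∀ {m} → (Vec ℕ m → Set) → Set₁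
  IsΠ zero    {m} P = Lift _ (Σ (PR m) λ f → ∀ v → P v ⇔ (⟦ f ⟧ v ≡ 0))
  IsΠ (suc k) {m} P = Σ (Vec ℕ (suc m) → Set) λ Q →
                        IsΣ k Q × (∀ v → P v ⇔ (∀ x → Q (x ∷ v)))

Pred¹ : (ℕ → Set) → Vec ℕ 1 → Set
Pred¹ P (a ∷ []) = P a

Pred² : (ℕ → ℕ → Set) → Vec ℕ 2 → Set
Pred² R (a ∷ b ∷ []) = R a b

Pred³ : (ℕ → ℕ → ℕ → Set) → Vec ℕ 3 → Set
Pred³ R (a ∷ b ∷ c ∷ []) = R a b c

-- a total function is computable iff its graph is Σ⁰₁
Computable¹ : (ℕ → ℕ) → Set₁
Computable¹ f = IsΣ 1 (Pred² λ a y → f a ≡ y)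

Computable² : (ℕ → ℕ → ℕ) → Set₁
Computable² f = IsΣ 1 (Pred³ λ a b y → f a b ≡ y)

-- Computable Boolean algebras (universe ω, elements = their codes)

record ComputableBA : Set₁ where
  infixr 7 _∧_
  infixr 6 _∨_
  infixl 7 _-_
  field
    _∨_ _∧_ : ℕ → ℕ → ℕ
    ¬_      : ℕ → ℕ
    ⊤ ⊥     : ℕ
    isBooleanAlgebra : IsBooleanAlgebra _≡_ _∨_ _∧_ ¬_ ⊤ ⊥
    ∨-computable : Computable² _∨_
    ∧-computable : Computable² _∧_
    ¬-computable : Computable¹ ¬_

  _-_ : ℕ → ℕ → ℕ
  a - b = a ∧ (¬ b)

  _≤_ : ℕ → ℕ → Set
  a ≤ b = a ∧ b ≡ a

  -- (possibly improper) ideals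
  record IsIdeal (I : ℕ → Set) : Set where
    field
      ⊥∈     : I ⊥
      ∨-closed : ∀ {a b} → I a → I b → I (a ∨ b)
      ↓-closed : ∀ {a b} → a ≤ b → I b → I a

  record IsHom (B : BooleanAlgebra 0ℓ 0ℓ) (h : ℕ → BooleanAlgebra.Carrier B) : Set where
    module B = BooleanAlgebra B
    field
      ∨-hom : ∀ a b → h (a ∨ b) B.≈ (h a B.∨ h b)
      ∧-hom : ∀ a b → h (a ∧ b) B.≈ (h a B.∧ h b)
      ¬-hom : ∀ a → h (¬ a) B.≈ (B.¬ h a)
      ⊤-hom : h ⊤ B.≈ B.⊤
      ⊥-hom : h ⊥ B.≈ B.⊥

  FreelyGeneratedBy : (ℕ → ℕ) → Set₁
  FreelyGeneratedBy p =
    (B : BooleanAlgebra 0ℓ 0ℓ) (g : ℕ → BooleanAlgebra.Carrier B) →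
      (Σ (ℕ → BooleanAlgebra.Carrier B) λ h →
         IsHom B h × (∀ n → BooleanAlgebra._≈_ B (h (p n)) (g n)))
      × (∀ h₁ h₂ → IsHom B h₁ → IsHom B h₂ →
           (∀ n → BooleanAlgebra._≈_ B (h₁ (p n)) (h₂ (p n))) →
           ∀ a → BooleanAlgebra._≈_ B (h₁ a) (h₂ a))

module Submission where

-- I is presented concretely: a ∈ I iff a ≤ ⋁_{i<N} (p nᵢ - p mᵢ) for finitely
-- many pairs nᵢ ≼ mᵢ, listed by one sequence code s.
-- * I is an ideal (lists concatenate) and contains every gap with n ≼ m.
-- * Separation: freeness gives a homomorphism into the two-element algebra
--   sending p x to "x is reachable from n along the listed pairs".  It kills
--   every listed gap but sends p n - p m to "m is unreachable"; hence m is
--   reachable, and n ≼ m by transitivity.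
-- * Complexity: a ∈ I iff ∃N ∃s [∀i<N (pair i of s is in ≼) ∧ a ∧ ⋁gaps = a],
--   which is Σ⁰ₖ since Σ⁰ₖ is closed under ∧, ∃ and bounded ∀, and the join is
--   computable, being defined by primitive recursion from computable steps.

open import Defs
open import Level using (0ℓ; lift)
open import Data.Nat using (ℕ; zero; suc; _+_; _*_; _∸_; _≤_; _<_; _≥_; z≤n; s≤s; pred; _≡ᵇ_; >-nonZero)
open import Data.Nat.Properties
open import Data.Fin using (Fin) renaming (zero to fz; suc to fs)
open import Data.Vec using (Vec; []; _∷_; lookup; tabulate; head; tail)
import Data.Vec as Vec
open import Data.Vec.Properties using (tabulate∘lookup)
open import Data.Product using (Σ; ∃; _×_; _,_; proj₁; proj₂)
open import Data.Sum using (_⊎_; inj₁; inj₂)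
open import Function using (id; _∘_)
open import Function.Bundles using (_⇔_; mk⇔; Equivalence)
open import Function.Construct.Composition using (_⇔-∘_)
open import Function.Construct.Symmetry using (⇔-sym)
open import Relation.Binary.PropositionalEquality
open import Data.Bool using (Bool; true; false; not; T) renaming (_∧_ to _∧ᵇ_; _∨_ to _∨ᵇ_)
open import Data.Bool.Properties using (T-∨; T-∧; T-≡; not-injective; ∧-zeroʳ; ∨-∧-booleanAlgebra)
open import Data.Empty using (⊥-elim)
open import Relation.Binary.Structures using (IsPreorder)
open import Algebra.Lattice.Bundles using (BooleanAlgebra)
open import Algebra.Lattice.Structures using (IsBooleanAlgebra)
import Algebra.Lattice.Properties.BooleanAlgebra as BooleanAlgebraProperties

open Equivalence using (to; from)

PrimRec : ∀ {m} → (Vec ℕ m → ℕ) → Set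
PrimRec {m} f = Σ (PR m) λ t → ∀ v → ⟦ t ⟧ v ≡ f v

PrimRec* : ∀ {m n} → (Vec ℕ m → Vec ℕ n) → Set
PrimRec* {m} {n} F = Σ (Vec (PR m) n) λ ts → ∀ v → ⟦ ts ⟧* v ≡ F v

pr-ext : ∀ {m} {f g : Vec ℕ m → ℕ} → PrimRec f → (∀ v → f v ≡ g v) → PrimRec g
pr-ext (t , ok) f≗g = t , λ v → trans (ok v) (f≗g v)

pr-[] : ∀ {m} → PrimRec* {m} (λ _ → [])
pr-[] = [] , λ _ → refl

pr-∷ : ∀ {m n} {f : Vec ℕ m → ℕ} {F : Vec ℕ m → Vec ℕ n} →
       PrimRec f → PrimRec* F → PrimRec* (λ v → f v ∷ F v)
pr-∷ (t , ok) (ts , oks) = t ∷ ts , λ v → cong₂ _∷_ (ok v) (oks v)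

pr-∘ : ∀ {m n} {f : Vec ℕ n → ℕ} {G : Vec ℕ m → Vec ℕ n} →
       PrimRec f → PrimRec* G → PrimRec (λ v → f (G v))
pr-∘ (t , ok) (ts , oks) = comp t ts , λ v → trans (cong ⟦ t ⟧ (oks v)) (ok _)

⟦map-comp⟧ : ∀ {m n k} (ts : Vec (PR n) k) (us : Vec (PR m) n) v →
             ⟦ Vec.map (λ t → comp t us) ts ⟧* v ≡ ⟦ ts ⟧* (⟦ us ⟧* v)
⟦map-comp⟧ [] us v = refl
⟦map-comp⟧ (t ∷ ts) us v = cong (⟦ t ⟧ (⟦ us ⟧* v) ∷_) (⟦map-comp⟧ ts us v)

pr-∘* : ∀ {m n k} {F : Vec ℕ n → Vec ℕ k} {G : Vec ℕ m → Vec ℕ n} →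
        PrimRec* F → PrimRec* G → PrimRec* (λ v → F (G v))
pr-∘* (ts , oks) (us , oku) =
  Vec.map (λ t → comp t us) ts ,
  λ v → trans (⟦map-comp⟧ ts us v) (trans (cong ⟦ ts ⟧* (oku v)) (oks _))

pr-lookup : ∀ {m} (i : Fin m) → PrimRec (λ v → lookup v i)
pr-lookup i = proj i , λ _ → refl

pr-head : ∀ {m} → PrimRec {suc m} head
pr-head = pr-ext (pr-lookup fz) λ { (x ∷ v) → refl }

⟦tabulate-proj⟧ : ∀ {m n} (σ : Fin n → Fin m) (v : Vec ℕ m) →
                  ⟦ tabulate (λ i → proj (σ i)) ⟧* v ≡ tabulate (λ i → lookup v (σ i))
⟦tabulate-proj⟧ {n = zero} σ v = refl
⟦tabulate-proj⟧ {n = suc n} σ v = cong (lookup v (σ fz) ∷_) (⟦tabulate-proj⟧ (σ ∘ fs) v)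

pr-tail : ∀ {m} → PrimRec* {suc m} tail
pr-tail = tabulate (λ i → proj (fs i)) ,
          λ { (x ∷ v) → trans (⟦tabulate-proj⟧ fs (x ∷ v)) (tabulate∘lookup v) }

pr-id : ∀ {m} → PrimRec* {m} id
pr-id = tabulate proj , λ v → trans (⟦tabulate-proj⟧ id v) (tabulate∘lookup v)

pr-second : ∀ {m} → PrimRec {suc (suc m)} (λ w → head (tail w))
pr-second = pr-∘ pr-head pr-tail

pr-drop₂ : ∀ {m} → PrimRec* {suc (suc m)} (λ w → tail (tail w))
pr-drop₂ = pr-∘* pr-tail pr-tail

pr-third : ∀ {m} → PrimRec {suc (suc (suc m))} (λ w → head (tail (tail w)))
pr-third = pr-∘ pr-head pr-drop₂

pr-drop₃ : ∀ {m} → PrimRec* {suc (suc (suc m))} (λ w → tail (tail (tail w)))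
pr-drop₃ = pr-∘* pr-drop₂ pr-tail

PrimRec₁ : (ℕ → ℕ) → Set
PrimRec₁ h = PrimRec {1} (λ v → h (head v))

PrimRec₂ : (ℕ → ℕ → ℕ) → Set
PrimRec₂ h = PrimRec {2} (λ v → h (head v) (head (tail v)))

pr-app₁ : ∀ {m} {f : Vec ℕ m → ℕ} {h : ℕ → ℕ} →
          PrimRec₁ h → PrimRec f → PrimRec (λ v → h (f v))
pr-app₁ ph pf = pr-∘ ph (pr-∷ pf pr-[])

pr-app₂ : ∀ {m} {f g : Vec ℕ m → ℕ} {h : ℕ → ℕ → ℕ} →
          PrimRec₂ h → PrimRec f → PrimRec g → PrimRec (λ v → h (f v) (g v))
pr-app₂ ph pf pg = pr-∘ ph (pr-∷ pf (pr-∷ pg pr-[]))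

pr-suc : PrimRec₁ suc
pr-suc = succ , λ { (x ∷ []) → refl }

pr-const : ∀ {m} k → PrimRec {m} (λ _ → k)
pr-const zero = zer , λ _ → refl
pr-const (suc k) = pr-app₁ {h = suc} pr-suc (pr-const k)

Recursion : ∀ {m} → (Vec ℕ (suc m) → ℕ) → (Vec ℕ m → ℕ) → (Vec ℕ (suc (suc m)) → ℕ) → Set
Recursion f b h = (∀ v → f (zero ∷ v) ≡ b v) × (∀ x v → f (suc x ∷ v) ≡ h (f (x ∷ v) ∷ x ∷ v))

pr-recursion : ∀ {m} {f : Vec ℕ (suc m) → ℕ} {b h} →
               PrimRec b → PrimRec h → Recursion f b h → PrimRec f
pr-recursion {f = f} {b} {h} (tb , okb) (th , okh) (f-zero , f-suc) = prec tb th , correct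
  where
  correct : ∀ w → ⟦ prec tb th ⟧ w ≡ f w
  correct (zero ∷ v) = trans (okb v) (sym (f-zero v))
  correct (suc x ∷ v) = begin
    ⟦ th ⟧ (⟦ prec tb th ⟧ (x ∷ v) ∷ x ∷ v) ≡⟨ cong (λ r → ⟦ th ⟧ (r ∷ x ∷ v)) (correct (x ∷ v)) ⟩
    ⟦ th ⟧ (f (x ∷ v) ∷ x ∷ v)             ≡⟨ okh _ ⟩
    h (f (x ∷ v) ∷ x ∷ v)                   ≡⟨ sym (f-suc x v) ⟩
    f (suc x ∷ v)                           ∎
    where open ≡-Reasoning

pr-pred : PrimRec₁ pred
pr-pred = pr-recursion {b = λ _ → 0} {h = λ w → lookup w (fs fz)}
            (pr-const 0) (pr-lookup (fs fz)) ((λ _ → refl) , (λ _ _ → refl))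

pr-+ : PrimRec₂ _+_
pr-+ = pr-recursion {b = head} {h = λ w → suc (head w)}
         pr-head (pr-app₁ {h = suc} pr-suc pr-head) ((λ _ → refl) , (λ _ _ → refl))

pr-* : PrimRec₂ _*_
pr-* = pr-recursion {b = λ _ → 0} {h = λ w → lookup w (fs (fs fz)) + head w}
                    (pr-const 0) (pr-app₂ {h = _+_} pr-+ (pr-lookup (fs (fs fz))) pr-head)
                    ((λ _ → refl) , (λ { _ (b ∷ []) → refl }))

-- Truncated subtraction recurses on the subtrahend, so it is built flipped.
pr-∸ : PrimRec₂ _∸_
pr-∸ = pr-ext (pr-app₂ {h = λ b a → a ∸ b} flipped (pr-lookup (fs fz)) (pr-lookup fz)) λ { (a ∷ b ∷ []) → refl }
  where
  flipped : PrimRec₂ (λ b a → a ∸ b)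
  flipped = pr-recursion {b = head} {h = λ w → pred (head w)} pr-head (pr-app₁ {h = pred} pr-pred pr-head)
              ((λ _ → refl) , (λ b v → sym (pred[m∸n]≡m∸[1+n] (head v) b)))

sumBelow : (ℕ → ℕ) → ℕ → ℕ
sumBelow h zero = 0
sumBelow h (suc n) = sumBelow h n + h n

pr-sumBelow : ∀ {m} {g : Vec ℕ (suc m) → ℕ} →
              PrimRec g → PrimRec (λ w → sumBelow (λ i → g (i ∷ tail w)) (head w))
pr-sumBelow {g = g} pg =
  pr-recursion {b = λ _ → 0} {h = λ w → head w + g (tail w)}
    (pr-const 0) (pr-app₂ {h = _+_} pr-+ pr-head (pr-∘ pg pr-tail)) ((λ _ → refl) , (λ _ _ → refl))

sumBelow-ones : ∀ h n → (∀ k → k < n → h k ≡ 1) → sumBelow h n ≡ n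
sumBelow-ones h zero _ = refl
sumBelow-ones h (suc n) ones =
  trans (cong₂ _+_ (sumBelow-ones h n (λ k k<n → ones k (m<n⇒m<1+n k<n))) (ones n ≤-refl)) (+-comm n 1)

sumBelow-zeros : ∀ h s d → (∀ k → s ≤ k → k < s + d → h k ≡ 0) → sumBelow h (s + d) ≡ sumBelow h s
sumBelow-zeros h s zero _ = cong (sumBelow h) (+-identityʳ s)
sumBelow-zeros h s (suc d) zeros rewrite +-suc s d = begin
  sumBelow h (s + d) + h (s + d) ≡⟨ cong₂ _+_ (sumBelow-zeros h s d zeros′) (zeros (s + d) (m≤m+n s d) ≤-refl) ⟩
  sumBelow h s + 0               ≡⟨ +-identityʳ _ ⟩
  sumBelow h s                   ∎
  where
  open ≡-Reasoning
  zeros′ : ∀ k → s ≤ k → k < s + d → h k ≡ 0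
  zeros′ k s≤k k<s+d = zeros k s≤k (m<n⇒m<1+n k<s+d)

sumBelow-indicator : ∀ h s z → s ≤ z → (∀ k → k < s → h k ≡ 1) →
                     (∀ k → s ≤ k → k < z → h k ≡ 0) → sumBelow h z ≡ s
sumBelow-indicator h s z s≤z ones zeros = begin
  sumBelow h z             ≡⟨ cong (sumBelow h) (sym (m+[n∸m]≡n s≤z)) ⟩
  sumBelow h (s + (z ∸ s)) ≡⟨ sumBelow-zeros h s (z ∸ s) (λ k s≤k k<z′ → zeros k s≤k (≤-trans k<z′ z′≤z)) ⟩
  sumBelow h s             ≡⟨ sumBelow-ones h s ones ⟩
  s                        ∎
  where
  open ≡-Reasoning
  z′≤z : s + (z ∸ s) ≤ z
  z′≤z = ≤-reflexive (m+[n∸m]≡n s≤z)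

-- Pairing ⟨x, y⟩ = (x + y)² + x.  The diagonal x + y is recovered as the
-- integer square root, computed by counting the k < z with (k + 1)² ≤ z.
pair : ℕ → ℕ → ℕ
pair x y = (x + y) * (x + y) + x

squareBelow : ℕ → ℕ → ℕ      -- 1 if (k + 1)² ≤ z, else 0
squareBelow z k = 1 ∸ (suc k * suc k ∸ z)

isqrt : ℕ → ℕ
isqrt z = sumBelow (squareBelow z) z

unpair₁ unpair₂ : ℕ → ℕ
unpair₁ z = z ∸ isqrt z * isqrt z
unpair₂ z = isqrt z ∸ unpair₁ z

isqrt-pair : ∀ x y → isqrt (pair x y) ≡ x + y
isqrt-pair x y = sumBelow-indicator (squareBelow z) s z s≤z below above
  where
  s = x + y
  z = pair x y
  s≤z : s ≤ z
  s≤z with s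
  ... | zero = z≤n
  ... | suc t = ≤-trans (m≤m*n (suc t) (suc t)) (m≤m+n _ x)
  below : ∀ k → k < s → squareBelow z k ≡ 1
  below k k<s = cong (1 ∸_) (m≤n⇒m∸n≡0 (≤-trans (*-mono-≤ k<s k<s) (m≤m+n (s * s) x)))
  z<next : z < suc s * suc s
  z<next = s≤s (begin
      s * s + x       ≤⟨ +-monoʳ-≤ (s * s) (m≤m+n x y) ⟩
      s * s + s       ≡⟨ +-comm (s * s) s ⟩
      s + s * s       ≤⟨ m≤n+m (s + s * s) s ⟩
      s + (s + s * s) ≡⟨ cong (s +_) (sym (*-suc s s)) ⟩
      s + s * suc s   ∎)
    where open ≤-Reasoning
  above : ∀ k → s ≤ k → k < z → squareBelow z k ≡ 0
  above k s≤k _ = trans (cong (1 ∸_) (sym (suc-pred _ {{>-nonZero (m<n⇒0<n∸m z<sq)}})))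
                        (0∸n≡0 (pred (suc k * suc k ∸ z)))
    where
    z<sq : z < suc k * suc k
    z<sq = <-≤-trans z<next (*-mono-≤ (s≤s s≤k) (s≤s s≤k))

unpair₁-pair : ∀ x y → unpair₁ (pair x y) ≡ x
unpair₁-pair x y rewrite isqrt-pair x y = m+n∸m≡n ((x + y) * (x + y)) x

unpair₂-pair : ∀ x y → unpair₂ (pair x y) ≡ y
unpair₂-pair x y rewrite unpair₁-pair x y | isqrt-pair x y = m+n∸m≡n x y

pr-isqrt : PrimRec₁ isqrt
pr-isqrt = pr-ext (pr-∘ (pr-sumBelow square) (pr-∷ pr-head (pr-∷ pr-head pr-[]))) λ { (z ∷ []) → refl }
  where
  square : PrimRec {2} (λ w → squareBelow (head (tail w)) (head w))
  square = pr-app₂ {h = _∸_} pr-∸ (pr-const 1)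
             (pr-app₂ {h = _∸_} pr-∸ (pr-app₂ {h = _*_} pr-* next next) pr-second)
    where next = pr-app₁ {h = suc} pr-suc pr-head

pr-unpair₁ : PrimRec₁ unpair₁
pr-unpair₁ = pr-app₂ {h = _∸_} pr-∸ pr-head (pr-app₂ {h = _*_} pr-* pr-isqrt pr-isqrt)

pr-unpair₂ : PrimRec₁ unpair₂
pr-unpair₂ = pr-app₂ {h = _∸_} pr-∸ pr-isqrt pr-unpair₁

-- Finite sequences: a code s lists the entries unpair₁ s, unpair₁ (unpair₂ s), …;
-- the i-th entry is read off after dropping i heads.
dropCode : ℕ → ℕ → ℕ
dropCode zero s = s
dropCode (suc i) s = unpair₂ (dropCode i s)

entry : ℕ → ℕ → ℕ
entry s i = unpair₁ (dropCode i s)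

dropCode-suc : ∀ i s → dropCode (suc i) s ≡ dropCode i (unpair₂ s)
dropCode-suc zero s = refl
dropCode-suc (suc i) s = cong unpair₂ (dropCode-suc i s)

pr-entry : PrimRec₂ entry
pr-entry = pr-app₁ {h = unpair₁} pr-unpair₁ (pr-app₂ {h = dropCode} dropping pr-second pr-head)
  where
  dropping : PrimRec₂ dropCode
  dropping = pr-recursion {b = head} {h = λ w → unpair₂ (head w)}
               pr-head (pr-app₁ {h = unpair₂} pr-unpair₂ pr-head) ((λ _ → refl) , (λ _ _ → refl))

entry-suc : ∀ s i → entry s (suc i) ≡ entry (unpair₂ s) i
entry-suc s i = cong unpair₁ (dropCode-suc i s)

entry-pair-suc : ∀ x s i → entry (pair x s) (suc i) ≡ entry s i
entry-pair-suc x s i = trans (entry-suc (pair x s) i) (cong (λ t → entry t i) (unpair₂-pair x s))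

-- Finite choice through sequence codes: witnesses for all i < b can be
-- collected into a single code.  This is what lets ∃ commute with bounded ∀.
collect : ∀ {R : ℕ → ℕ → Set} b → (∀ i → i < b → ∃ (R i)) → ∃ λ s → ∀ i → i < b → R i (entry s i)
collect zero _ = 0 , λ _ ()
collect {R} (suc b) witness
  with witness 0 (s≤s z≤n) | collect {λ i → R (suc i)} b (λ i i<b → witness (suc i) (s≤s i<b))
... | x , r₀ | s , rest = pair x s , chosen
  where
  chosen : ∀ i → i < suc b → R i (entry (pair x s) i)
  chosen zero _ = subst (R 0) (sym (unpair₁-pair x s)) r₀
  chosen (suc i) (s≤s i<b) = subst (R (suc i)) (sym (entry-pair-suc x s i)) (rest i i<b)

concatenation : ∀ N₁ s₁ s₂ →
                ∃ λ s → (∀ i → i < N₁ → entry s i ≡ entry s₁ i) × (∀ i → entry s (N₁ + i) ≡ entry s₂ i)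
concatenation zero s₁ s₂ = s₂ , (λ _ ()) , (λ _ → refl)
concatenation (suc N₁) s₁ s₂ with concatenation N₁ (unpair₂ s₁) s₂
... | s , front , back = pair (entry s₁ 0) s , front′ , back′
  where
  back′ : ∀ i → entry (pair (entry s₁ 0) s) (suc N₁ + i) ≡ entry s₂ i
  back′ i = trans (entry-pair-suc (entry s₁ 0) s (N₁ + i)) (back i)
  front′ : ∀ i → i < suc N₁ → entry (pair (entry s₁ 0) s) i ≡ entry s₁ i
  front′ zero _ = unpair₁-pair (entry s₁ 0) s
  front′ (suc i) (s≤s i<N₁) =
    trans (entry-pair-suc (entry s₁ 0) s i) (trans (front i i<N₁) (sym (entry-suc s₁ i)))

split< : ∀ N₁ {N₂ i} → i < N₁ + N₂ → i < N₁ ⊎ ∃ λ d → d < N₂ × i ≡ N₁ + d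
split< zero i<N₂ = inj₂ (_ , i<N₂ , refl)
split< (suc N₁) {i = zero} _ = inj₁ (s≤s z≤n)
split< (suc N₁) {i = suc i} (s≤s i<N) with split< N₁ i<N
... | inj₁ i<N₁ = inj₁ (s≤s i<N₁)
... | inj₂ (d , d<N₂ , refl) = inj₂ (d , d<N₂ , refl)

≡⇒⇔ : ∀ {A : Set} (P : A → Set) {a b} → a ≡ b → P a ⇔ P b
≡⇒⇔ P refl = mk⇔ id id

Σ-resp-⇔ : ∀ k {m} {P P′ : Vec ℕ m → Set} → IsΣ k P → (∀ v → P v ⇔ P′ v) → IsΣ k P′
Σ-resp-⇔ zero (lift (t , e)) P⇔P′ = lift (t , λ v → e v ⇔-∘ ⇔-sym (P⇔P′ v))
Σ-resp-⇔ (suc k) (Q , q , e) P⇔P′ = Q , q , λ v → e v ⇔-∘ ⇔-sym (P⇔P′ v)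

pr-extend : ∀ {m n} {F : Vec ℕ m → Vec ℕ n} → PrimRec* F → PrimRec* {suc m} (λ w → head w ∷ F (tail w))
pr-extend pF = pr-∷ pr-head (pr-∘* pF pr-tail)

mutual
  Σ-subst : ∀ k {m n} {P : Vec ℕ n → Set} {F : Vec ℕ m → Vec ℕ n} →
            IsΣ k P → PrimRec* F → IsΣ k (λ v → P (F v))
  Σ-subst zero {F = F} (lift (t , e)) (ts , ok) =
    lift (comp t ts , λ v → ≡⇒⇔ (λ u → ⟦ t ⟧ u ≡ 0) (sym (ok v)) ⇔-∘ e (F v))
  Σ-subst (suc k) {F = F} (Q , q , e) pF =
    (λ w → Q (head w ∷ F (tail w))) , Π-subst k q (pr-extend pF) , λ v → e (F v)

  Π-subst : ∀ k {m n} {P : Vec ℕ n → Set} {F : Vec ℕ m → Vec ℕ n} →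
            IsΠ k P → PrimRec* F → IsΠ k (λ v → P (F v))
  Π-subst zero p pF = Σ-subst zero p pF
  Π-subst (suc k) {F = F} (Q , q , e) pF =
    (λ w → Q (head w ∷ F (tail w))) , Σ-subst k q (pr-extend pF) , λ v → e (F v)

-- Quantifying over a dummy variable: PR relations lie in every Σₖ and Πₖ,
-- and each class is contained in the next one.
Σ₀⇒Σ×Π : ∀ k {m} {P : Vec ℕ m → Set} → IsΣ 0 P → IsΣ k P × IsΠ k P
Σ₀⇒Σ×Π zero p = p , p
Σ₀⇒Σ×Π (suc k) {P = P} p =
  ((λ w → P (tail w)) , Π-subst k (proj₂ (Σ₀⇒Σ×Π k p)) pr-tail , λ v → mk⇔ (0 ,_) proj₂) ,
  ((λ w → P (tail w)) , Σ-subst k (proj₁ (Σ₀⇒Σ×Π k p)) pr-tail , λ v → mk⇔ (λ x _ → x) (λ f → f 0))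

mutual
  Σ-step : ∀ k {m} {P : Vec ℕ m → Set} → IsΣ k P → IsΣ (suc k) P
  Σ-step zero {P = P} p = (λ w → P (tail w)) , Σ-subst zero p pr-tail , λ v → mk⇔ (0 ,_) proj₂
  Σ-step (suc k) (Q , q , e) = Q , Π-step k q , e

  Π-step : ∀ k {m} {P : Vec ℕ m → Set} → IsΠ k P → IsΠ (suc k) P
  Π-step zero {P = P} p = (λ w → P (tail w)) , Σ-subst zero p pr-tail , λ v → mk⇔ (λ x _ → x) (λ f → f 0)
  Π-step (suc k) (Q , q , e) = Q , Σ-step k q , e

Σ₁⇒Σ : ∀ k {m} {P : Vec ℕ m → Set} → IsΣ 1 P → IsΣ (suc k) P
Σ₁⇒Σ zero p = p
Σ₁⇒Σ (suc k) p = Σ-step (suc k) (Σ₁⇒Σ k p)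

-- Conjunction.  For PR relations add the two characteristic terms; for
-- existential blocks merge the two witnesses into one pair.
+≡0⇔ : ∀ a b → (a ≡ 0 × b ≡ 0) ⇔ (a + b ≡ 0)
+≡0⇔ a b = mk⇔ (λ { (refl , refl) → refl }) (λ a+b≡0 → m+n≡0⇒m≡0 a a+b≡0 , m+n≡0⇒n≡0 a a+b≡0)

Σ₀-× : ∀ {m} {P R : Vec ℕ m → Set} → IsΣ 0 P → IsΣ 0 R → IsΣ 0 (λ v → P v × R v)
Σ₀-× (lift (t , p)) (lift (u , r)) with pr-app₂ {h = _+_} pr-+ (t , λ _ → refl) (u , λ _ → refl)
... | (t+u , ok) = lift (t+u , λ v →
  ≡⇒⇔ (_≡ 0) (sym (ok v)) ⇔-∘ (+≡0⇔ (⟦ t ⟧ v) (⟦ u ⟧ v) ⇔-∘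
  mk⇔ (λ (x , y) → to (p v) x , to (r v) y) (λ (x , y) → from (p v) x , from (r v) y)))

pr-on-head : ∀ {m} {h : ℕ → ℕ} → PrimRec₁ h → PrimRec* {suc m} (λ w → h (head w) ∷ tail w)
pr-on-head {h = h} ph = pr-∷ (pr-app₁ {h = h} ph pr-head) pr-tail

mutual
  Σ-× : ∀ k {m} {P R : Vec ℕ m → Set} → IsΣ k P → IsΣ k R → IsΣ k (λ v → P v × R v)
  Σ-× zero p r = Σ₀-× p r
  Σ-× (suc k) (Q₁ , q₁ , e₁) (Q₂ , q₂ , e₂) =
    (λ w → Q₁ (unpair₁ (head w) ∷ tail w) × Q₂ (unpair₂ (head w) ∷ tail w)) ,
    Π-× k (Π-subst k q₁ (pr-on-head {h = unpair₁} pr-unpair₁))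
          (Π-subst k q₂ (pr-on-head {h = unpair₂} pr-unpair₂)) ,
    λ v → mk⇔
      (λ (p , r) → let (x , qx) = to (e₁ v) p ; (y , qy) = to (e₂ v) r in
        pair x y , subst (λ u → Q₁ (u ∷ v)) (sym (unpair₁-pair x y)) qx
                 , subst (λ u → Q₂ (u ∷ v)) (sym (unpair₂-pair x y)) qy)
      (λ (z , q₁z , q₂z) → from (e₁ v) (unpair₁ z , q₁z) , from (e₂ v) (unpair₂ z , q₂z))

  Π-× : ∀ k {m} {P R : Vec ℕ m → Set} → IsΠ k P → IsΠ k R → IsΠ k (λ v → P v × R v)
  Π-× zero p r = Σ₀-× p r
  Π-× (suc k) (Q₁ , q₁ , e₁) (Q₂ , q₂ , e₂) =
    (λ w → Q₁ w × Q₂ w) , Σ-× k q₁ q₂ ,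
    λ v → mk⇔ (λ (p , r) x → to (e₁ v) p x , to (e₂ v) r x)
              (λ f → from (e₁ v) (proj₁ ∘ f) , from (e₂ v) (proj₂ ∘ f))

-- Existential quantification over Σₖ₊₁: contract the two leading ∃ into one.
Σ-∃ : ∀ k {m} {P : Vec ℕ (suc m) → Set} → IsΣ (suc k) P → IsΣ (suc k) (λ v → ∃ λ x → P (x ∷ v))
Σ-∃ k (Q , q , e) =
  (λ w → Q (unpair₂ (head w) ∷ unpair₁ (head w) ∷ tail w)) ,
  Π-subst k q (pr-∷ (pr-app₁ {h = unpair₂} pr-unpair₂ pr-head) (pr-on-head {h = unpair₁} pr-unpair₁)) ,
  λ v → mk⇔
    (λ (x , px) → let (y , qxy) = to (e (x ∷ v)) px in
      pair x y , subst₂ (λ u u′ → Q (u ∷ u′ ∷ v)) (sym (unpair₂-pair x y)) (sym (unpair₁-pair x y)) qxy)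
    (λ (z , qz) → unpair₁ z , from (e (unpair₁ z ∷ v)) (unpair₂ z , qz))

∀< : ∀ {m} → (Vec ℕ (suc m) → Set) → Vec ℕ (suc m) → Set
∀< P w = ∀ i → i < head w → P (i ∷ tail w)

sumBelow≡0⇔ : ∀ h n → (∀ i → i < n → h i ≡ 0) ⇔ (sumBelow h n ≡ 0)
sumBelow≡0⇔ h n = mk⇔ (allZero⇒sum n) (sum⇒allZero n)
  where
  allZero⇒sum : ∀ n → (∀ i → i < n → h i ≡ 0) → sumBelow h n ≡ 0
  allZero⇒sum zero _ = refl
  allZero⇒sum (suc n) zeros = to (+≡0⇔ _ _) (allZero⇒sum n (λ i i<n → zeros i (m<n⇒m<1+n i<n)) , zeros n ≤-refl)
  sum⇒allZero : ∀ n → sumBelow h n ≡ 0 → ∀ i → i < n → h i ≡ 0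
  sum⇒allZero (suc n) sum≡0 i i<1+n with from (+≡0⇔ _ _) sum≡0 | m≤n⇒m<n∨m≡n (≤-pred i<1+n)
  ... | below , _ | inj₁ i<n = sum⇒allZero n below i i<n
  ... | _ , last | inj₂ refl = last

Σ₀-∀< : ∀ {m} {P : Vec ℕ (suc m) → Set} → IsΣ 0 P → IsΣ 0 (∀< P)
Σ₀-∀< (lift (t , e)) with pr-sumBelow (t , λ _ → refl)
... | u , ok = lift (u , λ w → ≡⇒⇔ (_≡ 0) (sym (ok w)) ⇔-∘ (sumBelow≡0⇔ _ (head w) ⇔-∘
  mk⇔ (λ H i i<b → to (e _) (H i i<b)) (λ H i i<b → from (e _) (H i i<b))))

swap : ∀ {m} → Vec ℕ (suc (suc m)) → Vec ℕ (suc (suc m))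
swap w = head (tail w) ∷ head w ∷ tail (tail w)

pr-swap : ∀ {m} → PrimRec* (swap {m})
pr-swap = pr-∷ pr-second (pr-∷ pr-head pr-drop₂)

-- (i ∷ s ∷ v) ↦ (entry s i ∷ i ∷ v): the i-th witness read off the code s.
withEntry : ∀ {m} → Vec ℕ (suc (suc m)) → Vec ℕ (suc (suc m))
withEntry w = entry (head (tail w)) (head w) ∷ head w ∷ tail (tail w)

pr-withEntry : ∀ {m} → PrimRec* (withEntry {m})
pr-withEntry = pr-∷ (pr-app₂ {h = entry} pr-entry pr-second pr-head) (pr-∷ pr-head pr-drop₂)

-- Σₖ and Πₖ are closed under bounded ∀: for Σₖ₊₁, the witnesses for all
-- i < b are collected into one code s, so ∀i<b ∃x Q becomes ∃s ∀i<b Q(entry s i).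
mutual
  Σ-∀< : ∀ k {m} {P : Vec ℕ (suc m) → Set} → IsΣ k P → IsΣ k (∀< P)
  Σ-∀< zero p = Σ₀-∀< p
  Σ-∀< (suc k) (Q , q , e) =
    (λ w → ∀< (λ u → Q (withEntry u)) (swap w)) ,
    Π-subst k (Π-∀< k (Π-subst k q pr-withEntry)) pr-swap ,
    λ { (b ∷ v) → mk⇔
         (λ H → collect b (λ i i<b → to (e (i ∷ v)) (H i i<b)))
         (λ (s , Qs) i i<b → from (e (i ∷ v)) (entry s i , Qs i i<b)) }

  Π-∀< : ∀ k {m} {P : Vec ℕ (suc m) → Set} → IsΠ k P → IsΠ k (∀< P)
  Π-∀< zero p = Σ₀-∀< p
  Π-∀< (suc k) (Q , q , e) =
    (λ w → ∀< (λ u → Q (swap u)) (swap w)) ,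
    Σ-subst k (Σ-∀< k (Σ-subst k q pr-swap)) pr-swap ,
    λ { (b ∷ v) → mk⇔ (λ H x i i<b → to (e (i ∷ v)) (H i i<b) x)
                      (λ H i i<b → from (e (i ∷ v)) (λ x → H x i i<b)) }

≡⇔∸+∸≡0 : ∀ a b → (a ≡ b) ⇔ ((a ∸ b) + (b ∸ a) ≡ 0)
≡⇔∸+∸≡0 a b = mk⇔ (λ { refl → cong₂ _+_ (n∸n≡0 a) (n∸n≡0 a) })
  (λ diff≡0 → let (a∸b≡0 , b∸a≡0) = from (+≡0⇔ _ _) diff≡0
              in ≤-antisym (m∸n≡0⇒m≤n a∸b≡0) (m∸n≡0⇒m≤n b∸a≡0))

Σ₀-≡ : ∀ {m} {f g : Vec ℕ m → ℕ} → PrimRec f → PrimRec g → IsΣ 0 (λ v → f v ≡ g v)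
Σ₀-≡ {f = f} {g} pf pg
  with pr-app₂ {h = _+_} pr-+ (pr-app₂ {h = _∸_} pr-∸ pf pg) (pr-app₂ {h = _∸_} pr-∸ pg pf)
... | t , ok = lift (t , λ v → ≡⇒⇔ (_≡ 0) (sym (ok v)) ⇔-∘ ≡⇔∸+∸≡0 (f v) (g v))

GraphΣ₁ : ∀ {m} → (Vec ℕ m → ℕ) → Set₁
GraphΣ₁ f = IsΣ 1 (λ w → f (tail w) ≡ head w)

PrimRec⇒GraphΣ₁ : ∀ {m} {f : Vec ℕ m → ℕ} → PrimRec f → GraphΣ₁ f
PrimRec⇒GraphΣ₁ pf = proj₁ (Σ₀⇒Σ×Π 1 (Σ₀-≡ (pr-∘ pf pr-tail) pr-head))

GraphΣ₁-subst : ∀ {m n} {f : Vec ℕ n → ℕ} {G : Vec ℕ m → Vec ℕ n} →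
                GraphΣ₁ f → PrimRec* G → GraphΣ₁ (λ v → f (G v))
GraphΣ₁-subst graph pG = Σ-subst 1 graph (pr-extend pG)

GraphΣ₁-≡ : ∀ {m} {f t : Vec ℕ m → ℕ} → GraphΣ₁ f → PrimRec t → IsΣ 1 (λ v → f v ≡ t v)
GraphΣ₁-≡ graph pt = Σ-subst 1 graph (pr-∷ pt pr-id)

-- Computable functions are closed under composition: h (f v) ≡ y iff
-- ∃ a. f v ≡ a × h a ≡ y.
GraphΣ₁-app₁ : ∀ {m} {f : Vec ℕ m → ℕ} (h : ℕ → ℕ) → Computable¹ h → GraphΣ₁ f → GraphΣ₁ (λ v → h (f v))
GraphΣ₁-app₁ {f = f} h graph-h graph-f =
  Σ-resp-⇔ 1 (Σ-∃ 0 (Σ-× 1 (Σ-subst 1 graph-f (pr-∷ pr-head pr-drop₂))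
                            (Σ-subst 1 graph-h (pr-∷ pr-head (pr-∷ pr-second pr-[])))))
    λ { (y ∷ v) → mk⇔ (λ (a , fv≡a , ha≡y) → trans (cong h fv≡a) ha≡y)
                      (λ h[fv]≡y → f v , refl , h[fv]≡y) }

GraphΣ₁-app₂ : ∀ {m} {f g : Vec ℕ m → ℕ} (h : ℕ → ℕ → ℕ) → Computable² h →
               GraphΣ₁ f → GraphΣ₁ g → GraphΣ₁ (λ v → h (f v) (g v))
GraphΣ₁-app₂ {f = f} {g} h graph-h graph-f graph-g =
  Σ-resp-⇔ 1 (Σ-∃ 0 (Σ-∃ 0 (Σ-× 1 (Σ-subst 1 graph-f (pr-∷ pr-head pr-drop₃))
                            (Σ-× 1 (Σ-subst 1 graph-g (pr-∷ pr-second pr-drop₃))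
                                   (Σ-subst 1 graph-h (pr-∷ pr-head (pr-∷ pr-second (pr-∷ pr-third pr-[]))))))))
    λ { (y ∷ v) → mk⇔ (λ (b , a , fv≡a , gv≡b , hab≡y) → trans (cong₂ h fv≡a gv≡b) hab≡y)
                      (λ h[fv,gv]≡y → g v , f v , refl , refl , h[fv,gv]≡y) }

-- Primitive recursion from a PR base b and a computable step h yields a
-- computable function: f (N ∷ v) ≡ y iff some code E lists a computation
-- history E₀ = b v, Eᵢ₊₁ = h (Eᵢ ∷ i ∷ v) for i < N, ending in E_N = y.
module _ {m} {f : Vec ℕ (suc m) → ℕ} {b : Vec ℕ m → ℕ} {h : Vec ℕ (suc (suc m)) → ℕ} where

  -- on (i ∷ E ∷ v): the i-th step of the history E is correct
  HistoryStep : Vec ℕ (suc (suc m)) → Set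
  HistoryStep w = h (withEntry w) ≡ entry (head (tail w)) (suc (head w))

  -- on (E ∷ y ∷ N ∷ v): E is a history of length N computing y
  History : Vec ℕ (suc (suc (suc m))) → Set
  History (E ∷ y ∷ N ∷ v) = (entry E 0 ≡ b v) × (entry E N ≡ y) × ∀< HistoryStep (N ∷ E ∷ v)

  history-correct : Recursion f b h → ∀ {E N v} → entry E 0 ≡ b v → ∀< HistoryStep (N ∷ E ∷ v) →
                    ∀ j → j ≤ N → entry E j ≡ f (j ∷ v)
  history-correct (f-zero , _) start _ zero _ = trans start (sym (f-zero _))
  history-correct rec@(_ , f-suc) {E} {N} {v} start steps (suc j) j<N = begin
    entry E (suc j)              ≡⟨ sym (steps j j<N) ⟩
    h (entry E j ∷ j ∷ v)        ≡⟨ cong (λ r → h (r ∷ j ∷ v)) (history-correct rec start steps j (<⇒≤ j<N)) ⟩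
    h (f (j ∷ v) ∷ j ∷ v)        ≡⟨ sym (f-suc j v) ⟩
    f (suc j ∷ v)                ∎
    where open ≡-Reasoning

  history-exists : Recursion f b h → ∀ N v → ∃ λ E → History (E ∷ f (N ∷ v) ∷ N ∷ v)
  history-exists (f-zero , f-suc) N v with collect {λ j x → x ≡ f (j ∷ v)} (suc N) (λ j _ → f (j ∷ v) , refl)
  ... | E , E≡f = E , trans (E≡f 0 (s≤s z≤n)) (f-zero v) , E≡f N ≤-refl , step
    where
    step : ∀< HistoryStep (N ∷ E ∷ v)
    step i i<N = begin
      h (entry E i ∷ i ∷ v)   ≡⟨ cong (λ r → h (r ∷ i ∷ v)) (E≡f i (m<n⇒m<1+n i<N)) ⟩
      h (f (i ∷ v) ∷ i ∷ v)   ≡⟨ sym (f-suc i v) ⟩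
      f (suc i ∷ v)           ≡⟨ sym (E≡f (suc i) (s≤s i<N)) ⟩
      entry E (suc i)         ∎
      where open ≡-Reasoning

  History-Σ₁ : PrimRec b → GraphΣ₁ h → IsΣ 1 History
  History-Σ₁ pb graph-h =
    Σ-resp-⇔ 1 (Σ-× 1 starts (Σ-× 1 ends steps)) λ { (E ∷ y ∷ N ∷ v) → mk⇔ id id }
    where
    starts : IsΣ 1 (λ w → entry (head w) 0 ≡ b (tail (tail (tail w))))
    starts = proj₁ (Σ₀⇒Σ×Π 1 (Σ₀-≡ (pr-app₂ {h = entry} pr-entry pr-head (pr-const 0)) (pr-∘ pb pr-drop₃)))
    ends : IsΣ 1 (λ w → entry (head w) (head (tail (tail w))) ≡ head (tail w))
    ends = proj₁ (Σ₀⇒Σ×Π 1 (Σ₀-≡ (pr-app₂ {h = entry} pr-entry pr-head pr-third) pr-second))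
    step : IsΣ 1 HistoryStep
    step = GraphΣ₁-≡ (GraphΣ₁-subst {f = h} graph-h pr-withEntry)
                     (pr-app₂ {h = entry} pr-entry pr-second (pr-app₁ {h = suc} pr-suc pr-head))
    steps : IsΣ 1 (λ w → ∀< HistoryStep (head (tail (tail w)) ∷ head w ∷ tail (tail (tail w))))
    steps = Σ-subst 1 (Σ-∀< 1 step) (pr-∷ pr-third (pr-∷ pr-head pr-drop₃))

  GraphΣ₁-recursion : PrimRec b → GraphΣ₁ h → Recursion f b h → GraphΣ₁ f
  GraphΣ₁-recursion pb graph-h rec = Σ-resp-⇔ 1 (Σ-∃ 0 (History-Σ₁ pb graph-h))
    λ { (y ∷ N ∷ v) → mk⇔
      (λ (E , start , end , steps) → trans (sym (history-correct rec start steps N ≤-refl)) end)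
      (λ { refl → history-exists rec N v }) }

-- A code s lists edges: its i-th entry codes the pair (src s i, tgt s i).
src tgt : ℕ → ℕ → ℕ
src s i = unpair₁ (entry s i)
tgt s i = unpair₂ (entry s i)

-- `reach s N n x`: x is reachable from n along the first N edges of s, as a
-- Boolean; edges are added one at a time, and a path needs the newest edge
-- at most once.
reach : ℕ → ℕ → ℕ → ℕ → Bool
reach s zero n x = x ≡ᵇ n
reach s (suc N) n x = reach s N n x ∨ᵇ (reach s N n (src s N) ∧ᵇ reach s N (tgt s N) x)

reach-refl : ∀ s N n → T (reach s N n n)
reach-refl s zero n = ≡⇒≡ᵇ n n refl
reach-refl s (suc N) n = from T-∨ (inj₁ (reach-refl s N n))

∧-not-false : ∀ x y → (T x → T y) → x ∧ᵇ not y ≡ false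
∧-not-false false y _ = refl
∧-not-false true false x⇒y = ⊥-elim (x⇒y _)
∧-not-false true true _ = refl

reach-closed : ∀ s N n i → i < N → T (reach s N n (src s i)) → T (reach s N n (tgt s i))
reach-closed s (suc N) n i i<1+N r with m≤n⇒m<n∨m≡n (≤-pred i<1+N) | to T-∨ r
... | inj₂ refl | r′ = from T-∨ (inj₂ (from T-∧ (reached r′ , reach-refl s N (tgt s N))))
  where
  reached : T (reach s N n (src s N)) ⊎ T (reach s N n (src s N) ∧ᵇ reach s N (tgt s N) (src s N)) →
            T (reach s N n (src s N))
  reached (inj₁ r₀) = r₀
  reached (inj₂ r₁) = proj₁ (to T-∧ r₁)
... | inj₁ i<N | inj₁ r₀ = from T-∨ (inj₁ (reach-closed s N n i i<N r₀))
... | inj₁ i<N | inj₂ r₁ with to T-∧ r₁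
...   | r-src , r-tgt = from T-∨ (inj₂ (from T-∧ (r-src , reach-closed s N (tgt s N) i i<N r-tgt)))

module Construction (𝓕 : ComputableBA) (p : ℕ → ℕ)
                    (_≼_ : ℕ → ℕ → Set) (≼-isPreorder : IsPreorder _≡_ _≼_) where
  open ComputableBA 𝓕 renaming (_≤_ to _⊑_)
  private
    module 𝓑 = IsBooleanAlgebra isBooleanAlgebra
    module ≼ = IsPreorder ≼-isPreorder

  𝓕-algebra : BooleanAlgebra 0ℓ 0ℓ
  𝓕-algebra = record { isBooleanAlgebra = isBooleanAlgebra }

  open BooleanAlgebraProperties 𝓕-algebra using (∨-identityˡ; ∨-identityʳ; ∧-idem)

  ⊑-trans : ∀ {a b c} → a ⊑ b → b ⊑ c → a ⊑ c
  ⊑-trans {a} {b} {c} a⊑b b⊑c = begin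
    a ∧ c       ≡⟨ cong (_∧ c) (sym a⊑b) ⟩
    (a ∧ b) ∧ c ≡⟨ 𝓑.∧-assoc a b c ⟩
    a ∧ (b ∧ c) ≡⟨ cong (a ∧_) b⊑c ⟩
    a ∧ b       ≡⟨ a⊑b ⟩
    a           ∎
    where open ≡-Reasoning

  ⊑-∨ˡ : ∀ x y → x ⊑ (x ∨ y)
  ⊑-∨ˡ x y = 𝓑.∧-absorbs-∨ x y

  ∨-mono-⊑ : ∀ {a b x y} → a ⊑ x → b ⊑ y → (a ∨ b) ⊑ (x ∨ y)
  ∨-mono-⊑ {a} {b} {x} {y} a⊑x b⊑y = begin
    (a ∨ b) ∧ (x ∨ y)             ≡⟨ 𝓑.∧-distribʳ-∨ (x ∨ y) a b ⟩
    (a ∧ (x ∨ y)) ∨ (b ∧ (x ∨ y)) ≡⟨ cong₂ _∨_ (⊑-trans a⊑x (⊑-∨ˡ x y))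
                                              (⊑-trans b⊑y (subst (y ⊑_) (𝓑.∨-comm y x) (⊑-∨ˡ y x))) ⟩
    a ∨ b                         ∎
    where open ≡-Reasoning

  gap : ℕ → ℕ
  gap e = p (unpair₁ e) - p (unpair₂ e)

  gaps : ℕ → ℕ → ℕ
  gaps zero s = ⊥
  gaps (suc N) s = gaps N s ∨ gap (entry s N)

  gaps-cong : ∀ N {s s′} → (∀ i → i < N → entry s i ≡ entry s′ i) → gaps N s ≡ gaps N s′
  gaps-cong zero _ = refl
  gaps-cong (suc N) agree =
    cong₂ (λ x e → x ∨ gap e) (gaps-cong N (λ i i<N → agree i (m<n⇒m<1+n i<N))) (agree N ≤-refl)

  gaps-concat : ∀ N₁ N₂ {s s₁ s₂} → (∀ i → i < N₁ → entry s i ≡ entry s₁ i) →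
                (∀ i → entry s (N₁ + i) ≡ entry s₂ i) → gaps (N₁ + N₂) s ≡ gaps N₁ s₁ ∨ gaps N₂ s₂
  gaps-concat N₁ zero {s} {s₁} front _ = begin
    gaps (N₁ + 0) s   ≡⟨ cong (λ N → gaps N s) (+-identityʳ N₁) ⟩
    gaps N₁ s         ≡⟨ gaps-cong N₁ front ⟩
    gaps N₁ s₁        ≡⟨ sym (∨-identityʳ _) ⟩
    gaps N₁ s₁ ∨ ⊥    ∎
    where open ≡-Reasoning
  gaps-concat N₁ (suc N₂) {s} {s₁} {s₂} front back = begin
    gaps (N₁ + suc N₂) s                               ≡⟨ cong (λ N → gaps N s) (+-suc N₁ N₂) ⟩
    gaps (N₁ + N₂) s ∨ gap (entry s (N₁ + N₂))
      ≡⟨ cong₂ (λ x e → x ∨ gap e) (gaps-concat N₁ N₂ front back) (back N₂) ⟩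
    (gaps N₁ s₁ ∨ gaps N₂ s₂) ∨ gap (entry s₂ N₂)      ≡⟨ 𝓑.∨-assoc _ _ _ ⟩
    gaps N₁ s₁ ∨ gaps (suc N₂) s₂                      ∎
    where open ≡-Reasoning

  Valid : ℕ → ℕ → Set
  Valid N s = ∀ i → i < N → src s i ≼ tgt s i

  Valid-init : ∀ {N s} → Valid (suc N) s → Valid N s
  Valid-init valid i i<N = valid i (m<n⇒m<1+n i<N)

  I : ℕ → Set
  I a = ∃ λ N → ∃ λ s → Valid N s × a ⊑ gaps N s

  I-∨-closed : ∀ {a b} → I a → I b → I (a ∨ b)
  I-∨-closed (N₁ , s₁ , valid₁ , a⊑) (N₂ , s₂ , valid₂ , b⊑) with concatenation N₁ s₁ s₂
  ... | s , front , back =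
    N₁ + N₂ , s , valid ,
    subst (_ ⊑_) (sym (gaps-concat N₁ N₂ front back)) (∨-mono-⊑ a⊑ b⊑)
    where
    valid : Valid (N₁ + N₂) s
    valid i i<N with split< N₁ i<N
    ... | inj₁ i<N₁ rewrite front i i<N₁ = valid₁ i i<N₁
    ... | inj₂ (d , d<N₂ , refl) rewrite back d = valid₂ d d<N₂

  I-isIdeal : IsIdeal I
  I-isIdeal = record
    { ⊥∈ = 0 , 0 , (λ _ ()) , ∧-idem ⊥
    ; ∨-closed = I-∨-closed
    ; ↓-closed = λ a⊑b (N , s , valid , b⊑) → N , s , valid , ⊑-trans a⊑b b⊑
    }

  gap∈I : ∀ {n m} → n ≼ m → I (p n - p m)
  gap∈I {n} {m} n≼m = 1 , s , valid , below
    where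
    s = pair (pair n m) 0
    src-edge : src s 0 ≡ n
    src-edge = trans (cong unpair₁ (unpair₁-pair (pair n m) 0)) (unpair₁-pair n m)
    tgt-edge : tgt s 0 ≡ m
    tgt-edge = trans (cong unpair₂ (unpair₁-pair (pair n m) 0)) (unpair₂-pair n m)
    valid : Valid 1 s
    valid zero _ = subst₂ _≼_ (sym src-edge) (sym tgt-edge) n≼m
    valid (suc i) (s≤s ())
    below : (p n - p m) ⊑ gaps 1 s
    below = begin
      (p n - p m) ∧ (⊥ ∨ (p (src s 0) - p (tgt s 0))) ≡⟨ cong ((p n - p m) ∧_) (∨-identityˡ _) ⟩
      (p n - p m) ∧ (p (src s 0) - p (tgt s 0))       ≡⟨ cong₂ (λ x y → (p n - p m) ∧ (p x - p y)) src-edge tgt-edge ⟩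
      (p n - p m) ∧ (p n - p m)                       ≡⟨ ∧-idem _ ⟩
      p n - p m                                       ∎
      where open ≡-Reasoning

  reach-sound : ∀ {s N n x} → Valid N s → T (reach s N n x) → n ≼ x
  reach-sound {N = zero} {n} {x} _ r = ≼.reflexive (sym (≡ᵇ⇒≡ x n r))
  reach-sound {s} {suc N} valid r with to T-∨ r
  ... | inj₁ r₀ = reach-sound (Valid-init valid) r₀
  ... | inj₂ r₁ with to T-∧ r₁
  ...   | r-src , r-tgt =
    ≼.trans (reach-sound (Valid-init valid) r-src) (≼.trans (valid N ≤-refl) (reach-sound (Valid-init valid) r-tgt))

  -- Map 𝓕 to the two-element algebra by sending p x to "x is reachable from n".
  -- Closure of the reachable set kills every valid gap, while p n - p m is
  -- sent to "m is not reachable"; so m must be reachable, hence n ≼ m.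
  module _ (free : FreelyGeneratedBy p) where

    separation : ∀ {n m N s} → Valid N s → (p n - p m) ⊑ gaps N s → n ≼ m
    separation {n} {m} {N} {s} valid below = reach-sound valid (from T-≡ (not-injective m-unreached))
      where
      induced = proj₁ (free ∨-∧-booleanAlgebra (reach s N n))
      open IsHom (proj₁ (proj₂ induced))
      h : ℕ → Bool
      h = proj₁ induced
      h-gen : ∀ x → h (p x) ≡ reach s N n x
      h-gen = proj₂ (proj₂ induced)

      h-gap : ∀ a b → h (p a - p b) ≡ reach s N n a ∧ᵇ not (reach s N n b)
      h-gap a b = trans (∧-hom _ _) (cong₂ _∧ᵇ_ (h-gen a) (trans (¬-hom _) (cong not (h-gen b))))

      -- a gap across an edge is killed, as reachability is closed under edges
      h-valid-gap : ∀ i → i < N → h (gap (entry s i)) ≡ false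
      h-valid-gap i i<N = trans (h-gap (src s i) (tgt s i)) (∧-not-false _ _ (reach-closed s N n i i<N))

      h-gaps : ∀ j → j ≤ N → h (gaps j s) ≡ false
      h-gaps zero _ = ⊥-hom
      h-gaps (suc j) j<N = trans (∨-hom _ _) (cong₂ _∨ᵇ_ (h-gaps j (<⇒≤ j<N)) (h-valid-gap j j<N))

      m-unreached : not (reach s N n m) ≡ false
      m-unreached = begin
        not (reach s N n m)
          ≡⟨ cong (λ x → x ∧ᵇ not (reach s N n m)) (sym (to T-≡ (reach-refl s N n))) ⟩
        reach s N n n ∧ᵇ not (reach s N n m)          ≡⟨ sym (h-gap n m) ⟩
        h (p n - p m)                                 ≡⟨ cong h (sym below) ⟩
        h ((p n - p m) ∧ gaps N s)                    ≡⟨ ∧-hom _ _ ⟩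
        h (p n - p m) ∧ᵇ h (gaps N s)                 ≡⟨ cong (h (p n - p m) ∧ᵇ_) (h-gaps N ≤-refl) ⟩
        h (p n - p m) ∧ᵇ false                        ≡⟨ ∧-zeroʳ _ ⟩
        false                                         ∎
        where open ≡-Reasoning

  -- Complexity: membership a ∈ I is ∃N ∃s. (∀i<N. src s i ≼ tgt s i) × a ∧ gaps N s ≡ a.
  -- The bounded ∀ keeps the first conjunct in Σₖ, and gaps is computable.
  module _ (p-computable : Computable¹ p) where

    gap-computable : GraphΣ₁ (λ v → gap (head v))
    gap-computable =
      GraphΣ₁-app₂ {f = λ v → p (unpair₁ (head v))} {g = λ v → ¬ p (unpair₂ (head v))}
        _∧_ ∧-computable (at unpair₁ pr-unpair₁)
        (GraphΣ₁-app₁ {f = λ v → p (unpair₂ (head v))} ¬_ ¬-computable (at unpair₂ pr-unpair₂))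
      where
      at : ∀ (π : ℕ → ℕ) → PrimRec₁ π → GraphΣ₁ {1} (λ v → p (π (head v)))
      at π pπ = GraphΣ₁-app₁ {f = λ v → π (head v)} p p-computable
                             (PrimRec⇒GraphΣ₁ (pr-app₁ {h = π} pπ pr-head))

    gaps-computable : GraphΣ₁ {2} (λ v → gaps (head v) (head (tail v)))
    gaps-computable =
      GraphΣ₁-recursion {f = λ v → gaps (head v) (head (tail v))} {b = λ _ → ⊥} {h = step}
        (pr-const ⊥) step-computable ((λ _ → refl) , (λ _ _ → refl))
      where
      -- on (r ∷ i ∷ s ∷ []): join the i-th gap of s onto r
      step : Vec ℕ 3 → ℕ
      step w = head w ∨ gap (entry (head (tail (tail w))) (head (tail w)))
      step-computable : GraphΣ₁ step
      step-computable = GraphΣ₁-app₂ {f = head} {g = λ w → gap (entry (head (tail (tail w))) (head (tail w)))}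
        _∨_ ∨-computable (PrimRec⇒GraphΣ₁ pr-head)
        (GraphΣ₁-subst {f = λ v → gap (head v)} gap-computable
          (pr-∷ (pr-app₂ {h = entry} pr-entry pr-third pr-second) pr-[]))

    I-Σ : ∀ k → IsΣ (suc k) (Pred² _≼_) → IsΣ (suc k) (Pred¹ I)
    I-Σ k ≼-Σ = Σ-resp-⇔ (suc k) (Σ-∃ k (Σ-∃ k (Σ-× (suc k) valid (Σ₁⇒Σ k below))))
                  λ { (a ∷ []) → mk⇔ id id }
      where
      -- predicates on (s ∷ N ∷ a ∷ [])
      edge : IsΣ (suc k) (λ w → src (head (tail w)) (head w) ≼ tgt (head (tail w)) (head w))
      edge = Σ-subst (suc k) ≼-Σ (pr-∷ (endpoint unpair₁ pr-unpair₁) (pr-∷ (endpoint unpair₂ pr-unpair₂) pr-[]))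
        where
        endpoint : ∀ (π : ℕ → ℕ) → PrimRec₁ π → PrimRec {3} (λ w → π (entry (head (tail w)) (head w)))
        endpoint π pπ = pr-app₁ {h = π} pπ (pr-app₂ {h = entry} pr-entry pr-second pr-head)
      valid : IsΣ (suc k) (λ w → Valid (head (tail w)) (head w))
      valid = Σ-subst (suc k) (Σ-∀< (suc k) edge) (pr-∷ pr-second (pr-∷ pr-head pr-drop₂))
      below : IsΣ 1 (λ w → head (tail (tail w)) ⊑ gaps (head (tail w)) (head w))
      below = GraphΣ₁-≡ (GraphΣ₁-app₂ {f = λ w → head (tail (tail w))} {g = λ w → gaps (head (tail w)) (head w)}
                          _∧_ ∧-computable (PrimRec⇒GraphΣ₁ pr-third)
                          (GraphΣ₁-subst {f = λ v → gaps (head v) (head (tail v))} gaps-computable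
                            (pr-∷ pr-second (pr-∷ pr-head pr-[]))))
                        pr-third

lemma4p3 : (k : ℕ) → k ≥ 1 →
    (𝓕 : ComputableBA) (p : ℕ → ℕ) → Computable¹ p →
    ComputableBA.FreelyGeneratedBy 𝓕 p →
    (_≼_ : ℕ → ℕ → Set) → IsPreorder _≡_ _≼_ → IsΣ k (Pred² _≼_) →
    Σ (ℕ → Set) λ I →
    ComputableBA.IsIdeal 𝓕 I × IsΣ k (Pred¹ I) ×
    (∀ n m → (n ≼ m) ⇔ I (ComputableBA._-_ 𝓕 (p n) (p m)))
lemma4p3 (suc k) _ 𝓕 p p-computable free _≼_ ≼-isPreorder ≼-Σ =
  I , I-isIdeal , I-Σ p-computable k ≼-Σ ,
  λ n m → mk⇔ gap∈I (λ (N , s , valid , below) → separation free valid below)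
  where open Construction 𝓕 p _≼_ ≼-isPreorder
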